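{- Let $0<\epsilon<1$ and let $I_L$ be a set of items with sizes $s(i)\in[\epsilon/14,1]$ such that $\mathrm{SIZE}(I_L)>\frac{8}{\epsilon}\left(\lceil\log(1/\epsilon)\rceil+5\right)$. Let $$k=\left\lfloor \frac{\mathrm{SIZE}(I_L)\cdot\epsilon}{2(\lfloor\log(1/\epsilon)\rfloor+5)}\right\rfloor,$$ and let $R$ be a rounding function on $I_L$ satisfying properties (a)–(d) below with parameter $k$. Then the number of non-empty groups $g$ (i.e. with $g[R]\neq\emptyset$) is $O\!\left(\frac{1}{\epsilon}\log\frac{1}{\epsilon}\right)$.
   Context: $\log$ denotes base-2 logarithm and $\mathrm{SIZE}(J)=\sum_{i\in J}s(i)$. For $\ell\in\mathbb{N}$ (including $0$), the size category $\ell$ consists of sizes in $(2^{ -(\ell+1)},2^{ -\ell}]$; $W$ is the set of size categories that can contain sizes $\ge \epsilon/14$, so $|W|\le\log(1/\epsilon)+5$. A group is a triple $(\ell,X,r)$ with $\ell\in W$, block $X\in\{A,B\}$ and position $r\in\mathbb{N}$ (including $0$). A rounding function is a map $R$ from $I_L$ to groups; $g[R]=\{i\in I_L: R(i)=g\}$, and $q(\ell,X)$ is the largest $r$ with $|(\ell,X,r)[R]|>0$. Properties with parameter $k$: (a) every $i\in(\ell,X,r)[R]$ has $2^{ -(\ell+1)}<s(i)\le 2^{ -\ell}$; (b) if $i\in(\ell,X,r)[R]$, $i'\in(\ell,X,r')[R]$ and $r<r'$ then $s(i)\ge s(i')$; (c) for each $\ell\in W$ and $1\le r\le q(\ell,A)$,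 $|(\ell,A,r)[R]|=2^{\ell}k$, and $|(\ell,A,0)[R]|\le 2^{\ell}k$; (d) for each $\ell\in W$ and $0\le r\le q(\ell,B)-1$, $|(\ell,B,r)[R]|=2^{\ell}(k-1)$, and $|(\ell,B,q(\ell,B))[R]|\le 2^{\ell}(k-1)$.
   Formalization: The parameter ε and the item sizes are rational. -}

module Defs where

open import Data.Nat as ℕ using (ℕ; zero; suc)
open import Data.Integer using (ℤ; +_)
open import Data.Rational as ℚ using (ℚ; 0ℚ; 1ℚ; ½; _/_)
open import Data.Fin using (Fin)
open import Data.List using (List; foldr; map; filter; length; deduplicate; allFin)
open import Data.Product using (_×_; _,_; proj₁; proj₂)
open import Data.Product.Properties using (≡-dec)
open import Relation.Binary.PropositionalEquality using (_≡_; refl)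
open import Relation.Nullary using (Dec; yes; no)
open import Relation.Binary.Definitions using (DecidableEquality)

toℚ : ℕ → ℚ
toℚ n = (+ n) / 1

half^ : ℕ → ℚ
half^ zero    = 1ℚ
half^ (suc ℓ) = ½ ℚ.* half^ ℓ

two^ : ℕ → ℚ
two^ ℓ = toℚ (2 ℕ.^ ℓ)

SIZE : ∀ {n} → (Fin n → ℚ) → ℚ
SIZE {n} s = foldr (λ i acc → s i ℚ.+ acc) 0ℚ (allFin n)

-- size category ℓ belongs to W : it can contain sizes ≥ ε/14, i.e. 2^{-ℓ} ≥ ε/14
InW : ℚ → ℕ → Set
InW ε ℓ = (ε ℚ.* ((+ 1) / 14)) ℚ.≤ half^ ℓ

data Block : Set where
  A B : Block

_≟B_ : DecidableEquality Block
A ≟B A = yes refl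
A ≟B B = no (λ ())
B ≟B A = no (λ ())
B ≟B B = yes refl

Group : Set
Group = ℕ × Block × ℕ

level : Group → ℕ
level g = proj₁ g

block : Group → Block
block g = proj₁ (proj₂ g)

pos : Group → ℕ
pos g = proj₂ (proj₂ g)

_≟G_ : DecidableEquality Group
_≟G_ = ≡-dec ℕ._≟_ (≡-dec _≟B_ ℕ._≟_)

card : ∀ {n} → (Fin n → Group) → Group → ℕ
card {n} R g = length (filter (λ i → R i ≟G g) (allFin n))

-- q(ℓ,X) : largest r with (ℓ,X,r)[R] non-empty (0 if there is none;
-- properties (c),(d) below are phrased so this default is harmless)
q : ∀ {n} → (Fin n → Group) → ℕ → Block → ℕ
q {n} R ℓ X = foldr ℕ._⊔_ 0 (map f (allFin n))
  where
  f : Fin n → ℕ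
  f i with level (R i) ℕ.≟ ℓ | block (R i) ≟B X
  ... | yes _ | yes _ = pos (R i)
  ... | _     | _     = 0

nonEmptyGroups : ∀ {n} → (Fin n → Group) → ℕ
nonEmptyGroups {n} R = length (deduplicate _≟G_ (map R (allFin n)))

PropA : ∀ {n} → (Fin n → ℚ) → (Fin n → Group) → Set
PropA s R = ∀ i → (half^ (suc (level (R i))) ℚ.< s i) × (s i ℚ.≤ half^ (level (R i)))

PropB : ∀ {n} → (Fin n → ℚ) → (Fin n → Group) → Set
PropB s R = ∀ i i' → level (R i) ≡ level (R i') → block (R i) ≡ block (R i') →
            pos (R i) ℕ.< pos (R i') → s i' ℚ.≤ s i

PropC : ∀ {n} → ℚ → (Fin n → Group) → ℕ → Set
PropC ε R k = ∀ ℓ → InW ε ℓ →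
  ((∀ r → 1 ℕ.≤ r → r ℕ.≤ q R ℓ A → card R (ℓ , A , r) ≡ 2 ℕ.^ ℓ ℕ.* k)
   × card R (ℓ , A , 0) ℕ.≤ 2 ℕ.^ ℓ ℕ.* k)

-- "0 ≤ r ≤ q(ℓ,B) - 1" is written r < q(ℓ,B)
PropD : ∀ {n} → ℚ → (Fin n → Group) → ℕ → Set
PropD ε R k = ∀ ℓ → InW ε ℓ →
  ((∀ r → r ℕ.< q R ℓ B → card R (ℓ , B , r) ≡ 2 ℕ.^ ℓ ℕ.* (k ℕ.∸ 1))
   × card R (ℓ , B , q R ℓ B) ℕ.≤ 2 ℕ.^ ℓ ℕ.* (k ℕ.∸ 1))

-- A level ℓ ∈ W has 2^ℓ ≤ 14/ε < 2^(Lf+5), so all levels lie in 0 … E with E = Lf + 4.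
-- Give an item of level ℓ the weight 2^(E − ℓ); its size exceeds 2^-(ℓ+1), so the total weight
-- U is at most 2^(E+1) · SIZE. Apart from the 2(E+1) groups (ℓ,A,0) and (ℓ,B,q(ℓ,B)), every
-- non-empty group has at least 2^ℓ (k − 1) items by (c) and (d), hence weight ≥ 2^E (k − 1).
-- Therefore 2^E (k−1) · #groups ≤ 2^E (k−1) · 2(E+1) + U. The choice of k gives
-- SIZE < (k+1) · 2(E+1)/ε, and the lower bound on SIZE forces k ≥ 4, so k + 1 ≤ 2(k − 1) and
-- #groups < 10(E+1)/ε ≤ 50 (Lf + 1)/ε.

module Submission where

open import Defs

module Counting where

  open import Data.Nat using (ℕ; zero; suc; _+_; _*_; _∸_; _^_; _≤_; _<_; _≟_; _⊔_; z≤n; s≤s)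
  open import Data.Nat.Properties
  open import Algebra.Properties.CommutativeSemigroup +-commutativeSemigroup using (interchange)
  open import Data.Fin using (Fin)
  open import Data.List using (List; []; _∷_; length; filter; map; foldr; allFin; deduplicate)
  open import Data.List.Membership.Propositional using (_∈_)
  open import Data.List.Membership.Propositional.Properties using (∈-allFin; ∈-map⁻; ∈-deduplicate⁻)
  open import Data.List.Relation.Unary.Any using (here; there)
  open import Data.List.Relation.Unary.All using (All; []; _∷_)
  open import Data.List.Relation.Unary.AllPairs using ([]; _∷_)
  open import Data.List.Relation.Unary.Unique.Propositional using (Unique)
  open import Data.List.Relation.Unary.Unique.DecPropositional.Properties using (deduplicate-!)
  open import Data.Product using (_,_; proj₁)
  open import Data.Rational using (ℚ)
  open import Data.Sum using (_⊎_; inj₁; inj₂)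
  open import Function using (const; id; _∘_)
  open import Relation.Binary.Definitions using (DecidableEquality)
  open import Relation.Binary.PropositionalEquality
  open import Relation.Nullary using (yes; no; contradiction)

  module _ {a} {A : Set a} where

    ∑ : List A → (A → ℕ) → ℕ
    ∑ []       f = 0
    ∑ (x ∷ xs) f = f x + ∑ xs f

    ∑-cong : ∀ xs {f g : A → ℕ} → (∀ x → f x ≡ g x) → ∑ xs f ≡ ∑ xs g
    ∑-cong []       f≗g = refl
    ∑-cong (x ∷ xs) f≗g = cong₂ _+_ (f≗g x) (∑-cong xs f≗g)

    ∑-mono : ∀ xs {f g : A → ℕ} → (∀ {x} → x ∈ xs → f x ≤ g x) → ∑ xs f ≤ ∑ xs g
    ∑-mono []       f≤g = z≤n
    ∑-mono (x ∷ xs) f≤g = +-mono-≤ (f≤g (here refl)) (∑-mono xs (f≤g ∘ there))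

    ∑-+ : ∀ xs (f g : A → ℕ) → ∑ xs (λ x → f x + g x) ≡ ∑ xs f + ∑ xs g
    ∑-+ []       f g = refl
    ∑-+ (x ∷ xs) f g =
      trans (cong (f x + g x +_) (∑-+ xs f g)) (interchange (f x) (g x) (∑ xs f) (∑ xs g))

    ∑-*ˡ : ∀ xs c (f : A → ℕ) → ∑ xs (λ x → c * f x) ≡ c * ∑ xs f
    ∑-*ˡ []       c f = sym (*-zeroʳ c)
    ∑-*ˡ (x ∷ xs) c f =
      trans (cong (c * f x +_) (∑-*ˡ xs c f)) (sym (*-distribˡ-+ c (f x) (∑ xs f)))

    ∑-const : ∀ xs c → ∑ xs (const c) ≡ c * length xs
    ∑-const []       c = sym (*-zeroʳ c)
    ∑-const (x ∷ xs) c = trans (cong (c +_) (∑-const xs c)) (sym (*-suc c (length xs)))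

  ∑-swap : ∀ {a b} {A : Set a} {B : Set b} xs ys (f : A → B → ℕ) →
           ∑ xs (λ x → ∑ ys (f x)) ≡ ∑ ys (λ y → ∑ xs (λ x → f x y))
  ∑-swap []       ys f = sym (∑-const ys 0)
  ∑-swap (x ∷ xs) ys f =
    trans (cong (∑ ys (f x) +_) (∑-swap xs ys f)) (sym (∑-+ ys (f x) (λ y → ∑ xs (λ x → f x y))))

  module DistinctValues {a} {G : Set a} (_≟_ : DecidableEquality G) where

    δ : G → G → ℕ
    δ x y with x ≟ y
    ... | yes _ = 1
    ... | no  _ = 0

    δ-refl : ∀ x → δ x x ≡ 1
    δ-refl x with x ≟ x
    ... | yes _   = refl
    ... | no  x≢x = contradiction refl x≢x

    ∑δ-∉ : ∀ {y gs} → All (y ≢_) gs → (h : G → ℕ) → ∑ gs (λ g → h g * δ y g) ≡ 0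
    ∑δ-∉ []          h = refl
    ∑δ-∉ {y} (_∷_ {g} {gs} y≢g y∉gs) h with y ≟ g
    ... | yes y≡g = contradiction y≡g y≢g
    ... | no  _   = trans (cong (_+ ∑ gs (λ g → h g * δ y g)) (*-zeroʳ (h g))) (∑δ-∉ y∉gs h)

    ∑δ-unique : ∀ {gs} → Unique gs → ∀ y (h : G → ℕ) → ∑ gs (λ g → h g * δ y g) ≤ h y
    ∑δ-unique []                           y h = z≤n
    ∑δ-unique (_∷_ {g} {gs} g∉gs gs-unique) y h with y ≟ g
    ... | yes refl = ≤-reflexive (trans (cong₂ _+_ (*-identityʳ (h y)) (∑δ-∉ g∉gs h)) (+-identityʳ (h y)))
    ... | no  _    = subst (_≤ h y) (cong (_+ ∑ gs (λ g → h g * δ y g)) (sym (*-zeroʳ (h g))))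
                             (∑δ-unique gs-unique y h)

    ∈⇒1≤∑δ : ∀ {x bs} → x ∈ bs → 1 ≤ ∑ bs (λ b → δ b x)
    ∈⇒1≤∑δ {x} (here refl) = ≤-trans (≤-reflexive (sym (δ-refl x))) (m≤m+n (δ x x) _)
    ∈⇒1≤∑δ {x} {b ∷ _} (there x∈bs) = ≤-trans (∈⇒1≤∑δ x∈bs) (m≤n+m _ (δ b x))

    length-filter≡∑δ : ∀ {b} {X : Set b} (f : X → G) g xs →
                       length (filter (λ x → f x ≟ g) xs) ≡ ∑ xs (λ x → δ (f x) g)
    length-filter≡∑δ f g []       = refl
    length-filter≡∑δ f g (x ∷ xs) with f x ≟ g
    ... | yes _ = cong suc (length-filter≡∑δ f g xs)
    ... | no  _ = length-filter≡∑δ f g xs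

    ∑∑δ-unique : ∀ {gs} → Unique gs → ∀ bs → ∑ gs (λ g → ∑ bs (λ b → δ b g)) ≤ length bs
    ∑∑δ-unique {gs} gs-unique bs = begin
      ∑ gs (λ g → ∑ bs (λ b → δ b g))   ≡⟨ ∑-swap gs bs (λ g b → δ b g) ⟩
      ∑ bs (λ b → ∑ gs (δ b))           ≡⟨ ∑-cong bs (λ b → ∑-cong gs (λ g → sym (*-identityˡ (δ b g)))) ⟩
      ∑ bs (λ b → ∑ gs (λ g → 1 * δ b g)) ≤⟨ ∑-mono bs (λ {b} _ → ∑δ-unique gs-unique b (const 1)) ⟩
      ∑ bs (const 1)                    ≡⟨ ∑-const bs 1 ⟩
      1 * length bs                     ≡⟨ *-identityˡ (length bs) ⟩
      length bs                         ∎
      where open ≤-Reasoning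

    ∑-fibres-unique : ∀ {gs} → Unique gs → ∀ {b} {X : Set b} (f : X → G) (h : G → ℕ) xs →
                      ∑ gs (λ g → h g * ∑ xs (λ x → δ (f x) g)) ≤ ∑ xs (λ x → h (f x))
    ∑-fibres-unique {gs} gs-unique f h xs = begin
      ∑ gs (λ g → h g * ∑ xs (λ x → δ (f x) g))
        ≡⟨ ∑-cong gs (λ g → sym (∑-*ˡ xs (h g) (λ x → δ (f x) g))) ⟩
      ∑ gs (λ g → ∑ xs (λ x → h g * δ (f x) g)) ≡⟨ ∑-swap gs xs (λ g x → h g * δ (f x) g) ⟩
      ∑ xs (λ x → ∑ gs (λ g → h g * δ (f x) g)) ≤⟨ ∑-mono xs (λ {x} _ → ∑δ-unique gs-unique (f x) h) ⟩
      ∑ xs (λ x → h (f x))                       ∎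
      where open ≤-Reasoning

    count-distinct : ∀ {gs} → Unique gs → ∀ bs (w : G → ℕ) c →
                     (∀ {g} → g ∈ gs → g ∈ bs ⊎ c ≤ w g) →
                     c * length gs ≤ c * length bs + ∑ gs w
    count-distinct {gs} gs-unique bs w c listed-or-heavy = begin
      c * length gs                                 ≡⟨ ∑-const gs c ⟨
      ∑ gs (const c)                                ≤⟨ ∑-mono gs c≤ ⟩
      ∑ gs (λ g → c * ∑ bs (λ b → δ b g) + w g)     ≡⟨ ∑-+ gs _ w ⟩
      ∑ gs (λ g → c * ∑ bs (λ b → δ b g)) + ∑ gs w  ≡⟨ cong (_+ ∑ gs w) (∑-*ˡ gs c _) ⟩
      c * ∑ gs (λ g → ∑ bs (λ b → δ b g)) + ∑ gs w
        ≤⟨ +-monoˡ-≤ (∑ gs w) (*-monoʳ-≤ c (∑∑δ-unique gs-unique bs)) ⟩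
      c * length bs + ∑ gs w                        ∎
      where
      open ≤-Reasoning
      c≤ : ∀ {g} → g ∈ gs → c ≤ c * ∑ bs (λ b → δ b g) + w g
      c≤ {g} g∈gs with listed-or-heavy g∈gs
      ... | inj₁ g∈bs = ≤-trans (≤-trans (≤-reflexive (sym (*-identityʳ c))) (*-monoʳ-≤ c (∈⇒1≤∑δ g∈bs)))
                                (m≤m+n _ (w g))
      ... | inj₂ c≤w  = ≤-trans c≤w (m≤n+m (w g) _)

  open DistinctValues _≟G_

  ∈⇒≤foldr-⊔ : ∀ {a} {X : Set a} (f : X → ℕ) {x xs} → x ∈ xs → f x ≤ foldr _⊔_ 0 (map f xs)
  ∈⇒≤foldr-⊔ f {xs = y ∷ _}  (here refl) = m≤m⊔n (f y) _
  ∈⇒≤foldr-⊔ f {xs = y ∷ _}  (there x∈xs) = ≤-trans (∈⇒≤foldr-⊔ f x∈xs) (m≤n⊔m (f y) _)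

  module _ {n} (R : Fin n → Group) where

    -- Abstracting the two tests lets the selector inside q reduce to pos (R i).
    pos≤q : ∀ i → pos (R i) ≤ q R (level (R i)) (block (R i))
    pos≤q i with level (R i) ≟ level (R i) | block (R i) ≟B block (R i)
               | id {A = _ ≤ q R (level (R i)) (block (R i))} (∈⇒≤foldr-⊔ _ (∈-allFin i))
    ... | yes _   | yes _   | pos≤ = pos≤
    ... | no  ℓ≢ℓ | _       | _    = contradiction refl ℓ≢ℓ
    ... | _       | no  X≢X | _    = contradiction refl X≢X

    boundaryGroups : ℕ → List Group
    boundaryGroups zero    = []
    boundaryGroups (suc d) = (d , A , 0) ∷ (d , B , q R d B) ∷ boundaryGroups d

    length-boundaryGroups : ∀ d → length (boundaryGroups d) ≡ 2 * d
    length-boundaryGroups zero    = refl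
    length-boundaryGroups (suc d) =
      trans (cong (suc ∘ suc) (length-boundaryGroups d)) (sym (*-suc 2 d))

    ∈-boundaryGroupsᴬ : ∀ {ℓ} d → ℓ < d → (ℓ , A , 0) ∈ boundaryGroups d
    ∈-boundaryGroupsᴬ {ℓ} (suc d) ℓ<1+d with ℓ ≟ d
    ... | yes refl = here refl
    ... | no  ℓ≢d  = there (there (∈-boundaryGroupsᴬ d (≤∧≢⇒< (≤-pred ℓ<1+d) ℓ≢d)))

    ∈-boundaryGroupsᴮ : ∀ {ℓ} d → ℓ < d → (ℓ , B , q R ℓ B) ∈ boundaryGroups d
    ∈-boundaryGroupsᴮ {ℓ} (suc d) ℓ<1+d with ℓ ≟ d
    ... | yes refl = there (here refl)
    ... | no  ℓ≢d  = there (there (∈-boundaryGroupsᴮ d (≤∧≢⇒< (≤-pred ℓ<1+d) ℓ≢d)))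

    module _ (ε : ℚ) (k E : ℕ) (inW : ∀ i → InW ε (level (R i))) (≤E : ∀ i → level (R i) ≤ E)
             (propC : PropC ε R k) (propD : PropD ε R k) where

      boundary-or-full : ∀ i → R i ∈ boundaryGroups (suc E) ⊎ 2 ^ level (R i) * (k ∸ 1) ≤ card R (R i)
      boundary-or-full i with R i | inW i | ≤E i | pos≤q i
      ... | ℓ , A , zero  | _   | ℓ≤E | _   = inj₁ (∈-boundaryGroupsᴬ (suc E) (s≤s ℓ≤E))
      ... | ℓ , A , suc r | ℓ∈W | _   | r<q =
        inj₂ (≤-trans (*-monoʳ-≤ (2 ^ ℓ) (m∸n≤m k 1))
                      (≤-reflexive (sym (proj₁ (propC ℓ ℓ∈W) (suc r) (s≤s z≤n) r<q))))
      ... | ℓ , B , r     | ℓ∈W | ℓ≤E | r≤q with r ≟ q R ℓ B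
      ...   | yes refl = inj₁ (∈-boundaryGroupsᴮ (suc E) (s≤s ℓ≤E))
      ...   | no  r≢q  = inj₂ (≤-reflexive (sym (proj₁ (propD ℓ ℓ∈W) r (≤∧≢⇒< r≤q r≢q))))

      nonEmptyGroups-bound :
        2 ^ E * (k ∸ 1) * nonEmptyGroups R ≤
        2 ^ E * (k ∸ 1) * (2 * suc E) + ∑ (allFin n) (λ i → 2 ^ (E ∸ level (R i)))
      nonEmptyGroups-bound = begin
        c * length gs
          ≤⟨ count-distinct gs-unique (boundaryGroups (suc E)) w c boundary-or-heavy ⟩
        c * length (boundaryGroups (suc E)) + ∑ gs w
          ≡⟨ cong (λ m → c * m + ∑ gs w) (length-boundaryGroups (suc E)) ⟩
        c * (2 * suc E) + ∑ gs w
          ≤⟨ +-monoʳ-≤ (c * (2 * suc E)) (∑-fibres-unique gs-unique R weight (allFin n)) ⟩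
        c * (2 * suc E) + ∑ (allFin n) (λ i → weight (R i)) ∎
        where
        open ≤-Reasoning
        c : ℕ
        c = 2 ^ E * (k ∸ 1)
        gs : List Group
        gs = deduplicate _≟G_ (map R (allFin n))
        gs-unique = deduplicate-! _≟G_ (map R (allFin n))
        weight : Group → ℕ
        weight g = 2 ^ (E ∸ level g)
        w : Group → ℕ
        w g = weight g * ∑ (allFin n) (λ i → δ (R i) g)
        full⇒heavy : ∀ i → 2 ^ level (R i) * (k ∸ 1) ≤ card R (R i) → c ≤ w (R i)
        full⇒heavy i full = begin
          2 ^ E * (k ∸ 1)                           ≡⟨ cong (λ m → 2 ^ m * (k ∸ 1)) (m∸n+n≡m (≤E i)) ⟨
          2 ^ (E ∸ ℓ + ℓ) * (k ∸ 1)                 ≡⟨ cong (_* (k ∸ 1)) (^-distribˡ-+-* 2 (E ∸ ℓ) ℓ) ⟩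
          2 ^ (E ∸ ℓ) * 2 ^ ℓ * (k ∸ 1)             ≡⟨ *-assoc (2 ^ (E ∸ ℓ)) (2 ^ ℓ) (k ∸ 1) ⟩
          2 ^ (E ∸ ℓ) * (2 ^ ℓ * (k ∸ 1))           ≤⟨ *-monoʳ-≤ (2 ^ (E ∸ ℓ)) full ⟩
          2 ^ (E ∸ ℓ) * card R (R i)                ≡⟨ cong (2 ^ (E ∸ ℓ) *_) (length-filter≡∑δ R (R i) (allFin n)) ⟩
          w (R i)                                   ∎
          where ℓ = level (R i)
        boundary-or-heavy : ∀ {g} → g ∈ gs → g ∈ boundaryGroups (suc E) ⊎ c ≤ w g
        boundary-or-heavy g∈gs with ∈-map⁻ R (∈-deduplicate⁻ _≟G_ (map R (allFin n)) g∈gs)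
        ... | i , _ , refl with boundary-or-full i
        ...   | inj₁ boundary = inj₁ boundary
        ...   | inj₂ full     = inj₂ (full⇒heavy i full)

open Counting using (∑; nonEmptyGroups-bound)

open import Algebra.Bundles using (CommutativeMonoid)
open import Data.Nat using (ℕ; zero; suc)
import Data.Nat as ℕ
import Data.Nat.Properties as ℕ
open import Data.Nat.Tactic.RingSolver using (solve-∀)
open import Data.Nat.Coprimality as Coprime using ()
open import Data.Integer using (+_)
import Data.Integer as ℤ
import Data.Integer.Properties as ℤ
import Data.Integer.DivMod as ℤ
open import Data.Rational
  using (ℚ; mkℚ; 0ℚ; 1ℚ; ½; _<_; _≤_; _*_; _+_; _/_; 1/_; toℚᵘ; floor; NonZero; NonNegative; Positive;
         *≤*; *<*; positive; nonNegative)
open import Data.Rational.Properties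
import Data.Rational.Unnormalised as ℚᵘ
import Data.Rational.Unnormalised.Properties as ℚᵘ
open import Data.Rational.Solver using (module +-*-Solver)
open +-*-Solver using (solve; _:*_; _:=_)
open import Algebra.Properties.CommutativeSemigroup
  (CommutativeMonoid.commutativeSemigroup *-1-commutativeMonoid) using (interchange)
open import Data.Fin using (Fin)
open import Data.List using (List; []; _∷_; foldr; allFin)
open import Data.Product using (Σ; _×_; proj₁; proj₂)
open import Relation.Binary.PropositionalEquality

2^-cancel-≤ : ∀ {m n} → 2 ℕ.^ m ℕ.≤ 2 ℕ.^ n → m ℕ.≤ n
2^-cancel-≤ 2^m≤2^n = ℕ.≮⇒≥ (λ n<m → ℕ.<⇒≱ (ℕ.^-monoʳ-< 2 (ℕ.s≤s (ℕ.s≤s ℕ.z≤n)) n<m) 2^m≤2^n)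

suc≤2*pred : ∀ {k} → 3 ℕ.≤ k → suc k ℕ.≤ 2 ℕ.* (k ℕ.∸ 1)
suc≤2*pred {suc K} (ℕ.s≤s 2≤K) =
  ℕ.≤-trans (ℕ.+-monoˡ-≤ K 2≤K) (ℕ.≤-reflexive (cong (K ℕ.+_) (sym (ℕ.+-identityʳ K))))

2^[1+E]*[1+k]*2D≤2^E*[k-1]*8D : ∀ E D {k} → 3 ℕ.≤ k →
  2 ℕ.^ suc E ℕ.* (suc k ℕ.* (2 ℕ.* D)) ℕ.≤ 2 ℕ.^ E ℕ.* (k ℕ.∸ 1) ℕ.* (8 ℕ.* D)
2^[1+E]*[1+k]*2D≤2^E*[k-1]*8D E D {k} 3≤k = begin
  2 ℕ.* P ℕ.* (suc k ℕ.* (2 ℕ.* D))   ≡⟨ lhs P k D ⟩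
  P ℕ.* (4 ℕ.* D) ℕ.* suc k          ≤⟨ ℕ.*-monoʳ-≤ (P ℕ.* (4 ℕ.* D)) (suc≤2*pred 3≤k) ⟩
  P ℕ.* (4 ℕ.* D) ℕ.* (2 ℕ.* K)      ≡⟨ rhs P K D ⟩
  P ℕ.* K ℕ.* (8 ℕ.* D)              ∎
  where
  open ℕ.≤-Reasoning
  P = 2 ℕ.^ E
  K = k ℕ.∸ 1
  lhs : ∀ P k D → 2 ℕ.* P ℕ.* (suc k ℕ.* (2 ℕ.* D)) ≡ P ℕ.* (4 ℕ.* D) ℕ.* suc k
  lhs = solve-∀
  rhs : ∀ P K D → P ℕ.* (4 ℕ.* D) ℕ.* (2 ℕ.* K) ≡ P ℕ.* K ℕ.* (8 ℕ.* D)
  rhs = solve-∀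

toℚ-mkℚ : ∀ n → toℚ n ≡ mkℚ (+ n) 0 (Coprime.sym (Coprime.1-coprimeTo n))
toℚ-mkℚ n = normalize-coprime (Coprime.sym (Coprime.1-coprimeTo n))

toℚ-+ : ∀ m n → toℚ (m ℕ.+ n) ≡ toℚ m + toℚ n
toℚ-+ m n rewrite toℚ-mkℚ m | toℚ-mkℚ n =
  /-cong (sym (cong₂ ℤ._+_ (ℤ.*-identityʳ (+ m)) (ℤ.*-identityʳ (+ n)))) refl

toℚ-* : ∀ m n → toℚ (m ℕ.* n) ≡ toℚ m * toℚ n
toℚ-* m n rewrite toℚ-mkℚ m | toℚ-mkℚ n = /-cong (ℤ.pos-* m n) refl

toℚ-mono-≤ : ∀ {m n} → m ℕ.≤ n → toℚ m ≤ toℚ n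
toℚ-mono-≤ {m} {n} m≤n rewrite toℚ-mkℚ m | toℚ-mkℚ n =
  *≤* (ℤ.*-monoʳ-≤-nonNeg (+ 1) (ℤ.+≤+ m≤n))

toℚ-mono-< : ∀ {m n} → m ℕ.< n → toℚ m < toℚ n
toℚ-mono-< {m} {n} m<n rewrite toℚ-mkℚ m | toℚ-mkℚ n =
  *<* (ℤ.*-monoʳ-<-pos (+ 1) (ℤ.+<+ m<n))

toℚ-cancel-< : ∀ {m n} → toℚ m < toℚ n → m ℕ.< n
toℚ-cancel-< h = ℕ.≰⇒> (λ n≤m → <-irrefl refl (<-≤-trans h (toℚ-mono-≤ n≤m)))

toℚ-cancel-≤ : ∀ {m n} → toℚ m ≤ toℚ n → m ℕ.≤ n
toℚ-cancel-≤ h = ℕ.≮⇒≥ (λ n<m → <-irrefl refl (<-≤-trans (toℚ-mono-< n<m) h))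

toℚ-nonNeg : ∀ n → NonNegative (toℚ n)
toℚ-nonNeg n = nonNegative (toℚ-mono-≤ (ℕ.z≤n {n}))

toℚ-pos : ∀ n .{{_ : ℕ.NonZero n}} → Positive (toℚ n)
toℚ-pos (suc n) = positive (toℚ-mono-< (ℕ.s≤s (ℕ.z≤n {n})))

1/n*n≡1 : ∀ n .{{_ : ℕ.NonZero n}} → (+ 1) / n * toℚ n ≡ 1ℚ
1/n*n≡1 (suc m) = toℚᵘ-injective (begin
  toℚᵘ ((+ 1) / suc m * toℚ (suc m))
    ≈⟨ toℚᵘ-homo-* ((+ 1) / suc m) (toℚ (suc m)) ⟩
  toℚᵘ ((+ 1) / suc m) ℚᵘ.* toℚᵘ (toℚ (suc m))
    ≈⟨ ℚᵘ.*-cong (toℚᵘ-fromℚᵘ (ℚᵘ.mkℚᵘ (+ 1) m)) (toℚᵘ-fromℚᵘ (ℚᵘ.mkℚᵘ (+ suc m) 0)) ⟩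
  ℚᵘ.1/ ℚᵘ.mkℚᵘ (+ suc m) 0 ℚᵘ.* ℚᵘ.mkℚᵘ (+ suc m) 0
    ≈⟨ ℚᵘ.*-inverseˡ (ℚᵘ.mkℚᵘ (+ suc m) 0) ⟩
  ℚᵘ.1ℚᵘ ∎)
  where open ℚᵘ.≃-Reasoning

floor-< : ∀ x k → + k ≡ floor x → x < toℚ (suc k)
floor-< (mkℚ num d-1 _) k k≡⌊x⌋ rewrite toℚ-mkℚ (suc k) = *<* (begin-strict
  num ℤ.* + 1                              ≡⟨ ℤ.*-identityʳ num ⟩
  num                                      ≡⟨ ℤ.a≡a%n+[a/n]*n num d ⟩
  + (num ℤ.% d) ℤ.+ (num ℤ./ d) ℤ.* d      ≡⟨ cong (λ z → + (num ℤ.% d) ℤ.+ z ℤ.* d) (sym k≡⌊x⌋) ⟩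
  + (num ℤ.% d) ℤ.+ + k ℤ.* d              <⟨ ℤ.+-monoˡ-< (+ k ℤ.* d) (ℤ.+<+ (ℤ.n%d<d num d)) ⟩
  d ℤ.+ + k ℤ.* d                          ≡⟨ ℤ.suc-* (+ k) d ⟨
  + suc k ℤ.* d                            ∎)
  where
  open ℤ.≤-Reasoning
  d = + suc d-1

two^-+ : ∀ m n → two^ (m ℕ.+ n) ≡ two^ m * two^ n
two^-+ m n = trans (cong toℚ (ℕ.^-distribˡ-+-* 2 m n)) (toℚ-* (2 ℕ.^ m) (2 ℕ.^ n))

two^*half^ : ∀ m → two^ m * half^ m ≡ 1ℚ
two^*half^ zero    = refl
two^*half^ (suc m) = begin
  two^ (suc m) * (½ * half^ m)       ≡⟨ cong (_* (½ * half^ m)) (toℚ-* 2 (2 ℕ.^ m)) ⟩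
  toℚ 2 * two^ m * (½ * half^ m)     ≡⟨ interchange (toℚ 2) (two^ m) ½ (half^ m) ⟩
  toℚ 2 * ½ * (two^ m * half^ m)     ≡⟨ cong (toℚ 2 * ½ *_) (two^*half^ m) ⟩
  1ℚ                                 ∎
  where open ≡-Reasoning

two^-pos : ∀ m → Positive (two^ m)
two^-pos m = toℚ-pos (2 ℕ.^ m) {{ℕ.m^n≢0 2 m}}

half^≤⇒two^≤ : ∀ a m {x} → half^ m ≤ x → two^ a ≤ two^ (a ℕ.+ m) * x
half^≤⇒two^≤ a m {x} half^m≤x = begin
  two^ a                              ≡⟨ *-identityʳ (two^ a) ⟨
  two^ a * 1ℚ                         ≡⟨ cong (two^ a *_) (two^*half^ m) ⟨
  two^ a * (two^ m * half^ m)         ≡⟨ *-assoc (two^ a) (two^ m) (half^ m) ⟨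
  two^ a * two^ m * half^ m           ≡⟨ cong (_* half^ m) (two^-+ a m) ⟨
  two^ (a ℕ.+ m) * half^ m
    ≤⟨ *-monoˡ-≤-nonNeg (two^ (a ℕ.+ m)) {{toℚ-nonNeg (2 ℕ.^ (a ℕ.+ m))}} half^m≤x ⟩
  two^ (a ℕ.+ m) * x                  ∎
  where open ≤-Reasoning

toℚ-∑≤ : ∀ {a} {X : Set a} (r : ℚ) (u : X → ℕ) (s : X → ℚ) xs → (∀ x → toℚ (u x) ≤ r * s x) →
         toℚ (∑ xs u) ≤ r * foldr (λ x acc → s x + acc) 0ℚ xs
toℚ-∑≤ r u s []       u≤rs = ≤-reflexive (sym (*-zeroʳ r))
toℚ-∑≤ r u s (x ∷ xs) u≤rs = begin
  toℚ (u x ℕ.+ ∑ xs u)                     ≡⟨ toℚ-+ (u x) (∑ xs u) ⟩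
  toℚ (u x) + toℚ (∑ xs u)                 ≤⟨ +-mono-≤ (u≤rs x) (toℚ-∑≤ r u s xs u≤rs) ⟩
  r * s x + r * foldr (λ x acc → s x + acc) 0ℚ xs ≡⟨ *-distribˡ-+ r (s x) _ ⟨
  r * (s x + foldr (λ x acc → s x + acc) 0ℚ xs) ∎
  where open ≤-Reasoning

scaled-count⇒bound : ∀ c N a b U {p} → 1ℚ ≤ p →
  c ℕ.* N ℕ.≤ c ℕ.* a ℕ.+ U → toℚ U < toℚ (c ℕ.* b) * p → toℚ N < toℚ (a ℕ.+ b) * p
scaled-count⇒bound c N a b U {p} 1≤p count U<cbp =
  *-cancelˡ-<-nonNeg (toℚ c) {{toℚ-nonNeg c}} (begin-strict
    toℚ c * toℚ N                      ≡⟨ toℚ-* c N ⟨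
    toℚ (c ℕ.* N)                      ≤⟨ toℚ-mono-≤ count ⟩
    toℚ (c ℕ.* a ℕ.+ U)                ≡⟨ toℚ-+ (c ℕ.* a) U ⟩
    toℚ (c ℕ.* a) + toℚ U              ≤⟨ +-monoˡ-≤ (toℚ U) ca≤cap ⟩
    toℚ (c ℕ.* a) * p + toℚ U          <⟨ +-monoʳ-< (toℚ (c ℕ.* a) * p) U<cbp ⟩
    toℚ (c ℕ.* a) * p + toℚ (c ℕ.* b) * p ≡⟨ *-distribʳ-+ p (toℚ (c ℕ.* a)) (toℚ (c ℕ.* b)) ⟨
    (toℚ (c ℕ.* a) + toℚ (c ℕ.* b)) * p  ≡⟨ cong (_* p) (toℚ-+ (c ℕ.* a) (c ℕ.* b)) ⟨
    toℚ (c ℕ.* a ℕ.+ c ℕ.* b) * p      ≡⟨ cong (λ m → toℚ m * p) (ℕ.*-distribˡ-+ c a b) ⟨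
    toℚ (c ℕ.* (a ℕ.+ b)) * p          ≡⟨ cong (_* p) (toℚ-* c (a ℕ.+ b)) ⟩
    toℚ c * toℚ (a ℕ.+ b) * p          ≡⟨ *-assoc (toℚ c) (toℚ (a ℕ.+ b)) p ⟩
    toℚ c * (toℚ (a ℕ.+ b) * p)        ∎)
  where
  open ≤-Reasoning
  ca≤cap : toℚ (c ℕ.* a) ≤ toℚ (c ℕ.* a) * p
  ca≤cap = begin
    toℚ (c ℕ.* a)        ≡⟨ *-identityʳ (toℚ (c ℕ.* a)) ⟨
    toℚ (c ℕ.* a) * 1ℚ   ≤⟨ *-monoˡ-≤-nonNeg (toℚ (c ℕ.* a)) {{toℚ-nonNeg (c ℕ.* a)}} 1≤p ⟩
    toℚ (c ℕ.* a) * p    ∎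

weights≤two^*SIZE : ∀ {n} (s : Fin n → ℚ) (R : Fin n → Group) E → PropA s R →
  (∀ i → level (R i) ℕ.≤ E) →
  toℚ (∑ (allFin n) (λ i → 2 ℕ.^ (E ℕ.∸ level (R i)))) ≤ two^ (suc E) * SIZE s
weights≤two^*SIZE s R E propA ≤E = toℚ-∑≤ (two^ (suc E)) _ s (allFin _) weight≤
  where
  weight≤ : ∀ i → two^ (E ℕ.∸ level (R i)) ≤ two^ (suc E) * s i
  weight≤ i = subst (λ m → two^ (E ℕ.∸ ℓ) ≤ two^ m * s i)
    (trans (ℕ.+-suc (E ℕ.∸ ℓ) ℓ) (cong suc (ℕ.m∸n+n≡m (≤E i))))
    (half^≤⇒two^≤ (E ℕ.∸ ℓ) (suc ℓ) (<⇒≤ (proj₁ (propA i))))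
    where ℓ = level (R i)

module _ (ε : ℚ) .{{_ : NonZero ε}} (ε>0 : 0ℚ < ε) where

  private
    p = 1/ ε
    instance
      p-pos : Positive p
      p-pos = 1/pos⇒pos ε {{positive ε>0}}
      p-nonNeg : NonNegative p
      p-nonNeg = pos⇒nonNeg p

  1≤1/ε : ε ≤ 1ℚ → 1ℚ ≤ 1/ ε
  1≤1/ε ε≤1 = begin
    1ℚ       ≡⟨ *-inverseʳ ε ⟨
    ε * p    ≤⟨ *-monoʳ-≤-nonNeg p ε≤1 ⟩
    1ℚ * p   ≡⟨ *-identityˡ p ⟩
    p        ∎
    where open ≤-Reasoning

  two^≤14/ε : ∀ {ℓ} → InW ε ℓ → two^ ℓ ≤ toℚ 14 * 1/ ε
  two^≤14/ε {ℓ} ℓ∈W = begin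
    two^ ℓ                         ≡⟨ scale-left ⟨
    ε * t * (two^ ℓ * (F * p))     ≤⟨ *-monoʳ-≤-nonNeg (two^ ℓ * (F * p)) {{r-nonNeg}} ℓ∈W ⟩
    half^ ℓ * (two^ ℓ * (F * p))   ≡⟨ scale-right ⟩
    F * p                          ∎
    where
    open ≤-Reasoning
    t = (+ 1) / 14
    F = toℚ 14
    r-nonNeg = pos⇒nonNeg (two^ ℓ * (F * p))
                 {{pos*pos⇒pos (two^ ℓ) {{two^-pos ℓ}} (F * p) {{pos*pos⇒pos F {{toℚ-pos 14}} p}}}}
    scale-left : ε * t * (two^ ℓ * (F * p)) ≡ two^ ℓ
    scale-left = begin-equality
      ε * t * (two^ ℓ * (F * p))
        ≡⟨ solve 5 (λ e t T F q → e :* t :* (T :* (F :* q)) := e :* q :* (t :* F) :* T) refl ε t (two^ ℓ) F p ⟩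
      ε * p * (t * F) * two^ ℓ     ≡⟨ cong₂ (λ a b → a * b * two^ ℓ) (*-inverseʳ ε) (1/n*n≡1 14) ⟩
      1ℚ * 1ℚ * two^ ℓ             ≡⟨ *-identityˡ (two^ ℓ) ⟩
      two^ ℓ                       ∎
    scale-right : half^ ℓ * (two^ ℓ * (F * p)) ≡ F * p
    scale-right = begin-equality
      half^ ℓ * (two^ ℓ * (F * p))
        ≡⟨ solve 3 (λ h T X → h :* (T :* X) := T :* h :* X) refl (half^ ℓ) (two^ ℓ) (F * p) ⟩
      two^ ℓ * half^ ℓ * (F * p)   ≡⟨ cong (_* (F * p)) (two^*half^ ℓ) ⟩
      1ℚ * (F * p)                 ≡⟨ *-identityˡ (F * p) ⟩
      F * p                        ∎

  level-bound : ∀ Lf {ℓ} → 1/ ε < two^ (suc Lf) → InW ε ℓ → ℓ ℕ.≤ 4 ℕ.+ Lf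
  level-bound Lf {ℓ} p<2^[1+Lf] ℓ∈W =
    ℕ.≮⇒≥ (λ 4+Lf<ℓ → ℕ.<⇒≱ 2^ℓ<2^[5+Lf] (ℕ.^-monoʳ-≤ 2 4+Lf<ℓ))
    where
    open ≤-Reasoning
    2^ℓ<14*2^[1+Lf] : 2 ℕ.^ ℓ ℕ.< 14 ℕ.* 2 ℕ.^ suc Lf
    2^ℓ<14*2^[1+Lf] = toℚ-cancel-< (begin-strict
      two^ ℓ                          ≤⟨ two^≤14/ε {ℓ} ℓ∈W ⟩
      toℚ 14 * p                      <⟨ *-monoʳ-<-pos (toℚ 14) {{toℚ-pos 14}} p<2^[1+Lf] ⟩
      toℚ 14 * two^ (suc Lf)          ≡⟨ toℚ-* 14 (2 ℕ.^ suc Lf) ⟨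
      toℚ (14 ℕ.* 2 ℕ.^ suc Lf)       ∎)
    2^ℓ<2^[5+Lf] : 2 ℕ.^ ℓ ℕ.< 2 ℕ.^ (5 ℕ.+ Lf)
    2^ℓ<2^[5+Lf] = ℕ.<-≤-trans 2^ℓ<14*2^[1+Lf]
      (ℕ.≤-trans (ℕ.*-monoˡ-≤ (2 ℕ.^ suc Lf) (ℕ.m≤m+n 14 2))
                 (ℕ.≤-reflexive (sym (ℕ.^-distribˡ-+-* 2 4 (suc Lf)))))

  floor-bound : ∀ S k M .{{_ : ℕ.NonZero M}} → + k ≡ floor (S * ε * ((+ 1) / M)) →
                S < toℚ (suc k ℕ.* M) * 1/ ε
  floor-bound S k M k≡⌊x⌋ = begin-strict
    S                             ≡⟨ rescale ⟨
    S * ε * t * (toℚ M * p)       <⟨ *-monoˡ-<-pos (toℚ M * p) {{Mp-pos}} (floor-< (S * ε * t) k k≡⌊x⌋) ⟩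
    toℚ (suc k) * (toℚ M * p)     ≡⟨ *-assoc (toℚ (suc k)) (toℚ M) p ⟨
    toℚ (suc k) * toℚ M * p       ≡⟨ cong (_* p) (toℚ-* (suc k) M) ⟨
    toℚ (suc k ℕ.* M) * p         ∎
    where
    open ≤-Reasoning
    t = (+ 1) / M
    Mp-pos = pos*pos⇒pos (toℚ M) {{toℚ-pos M}} p
    rescale : S * ε * t * (toℚ M * p) ≡ S
    rescale = begin-equality
      S * ε * t * (toℚ M * p)
        ≡⟨ solve 5 (λ S e t F q → S :* e :* t :* (F :* q) := S :* (e :* q) :* (t :* F)) refl S ε t (toℚ M) p ⟩
      S * (ε * p) * (t * toℚ M)   ≡⟨ cong₂ (λ a b → S * a * b) (*-inverseʳ ε) (1/n*n≡1 M) ⟩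
      S * 1ℚ * 1ℚ                 ≡⟨ trans (*-identityʳ (S * 1ℚ)) (*-identityʳ S) ⟩
      S                           ∎

  k-large : ∀ {S} k D L → D ℕ.≤ L → toℚ 8 * 1/ ε * toℚ L < S →
            S < toℚ (suc k ℕ.* (2 ℕ.* D)) * 1/ ε → 3 ℕ.< k
  k-large {S} k D L D≤L S-large S<… =
    ℕ.≤-pred (ℕ.*-cancelʳ-< (2 ℕ.* D) 4 (suc k) (subst (ℕ._< suc k ℕ.* (2 ℕ.* D)) (ℕ.*-assoc 4 2 D) 8D<…))
    where
    open ≤-Reasoning
    8D<… : 8 ℕ.* D ℕ.< suc k ℕ.* (2 ℕ.* D)
    8D<… = toℚ-cancel-< (*-cancelʳ-<-nonNeg p (begin-strict
      toℚ (8 ℕ.* D) * p         ≡⟨ cong (_* p) (toℚ-* 8 D) ⟩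
      toℚ 8 * toℚ D * p         ≡⟨ solve 3 (λ a d q → a :* d :* q := a :* q :* d) refl (toℚ 8) (toℚ D) p ⟩
      toℚ 8 * p * toℚ D         ≤⟨ *-monoˡ-≤-nonNeg (toℚ 8 * p) {{8p-nonNeg}} (toℚ-mono-≤ D≤L) ⟩
      toℚ 8 * p * toℚ L         <⟨ S-large ⟩
      S                         <⟨ S<… ⟩
      toℚ (suc k ℕ.* (2 ℕ.* D)) * p ∎))
      where 8p-nonNeg = pos⇒nonNeg (toℚ 8 * p) {{pos*pos⇒pos (toℚ 8) {{toℚ-pos 8}} p}}


  nonEmptyGroups<[2D+8D]/ε :
    ∀ Lf {n} (s : Fin n → ℚ) (R : Fin n → Group) k → ε ≤ 1ℚ → 1/ ε < two^ (suc Lf) →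
    (∀ i → InW ε (level (R i))) → PropA s R → PropC ε R k → PropD ε R k →
    3 ℕ.≤ k → SIZE s < toℚ (suc k ℕ.* (2 ℕ.* (5 ℕ.+ Lf))) * 1/ ε →
    toℚ (nonEmptyGroups R) < toℚ (2 ℕ.* (5 ℕ.+ Lf) ℕ.+ 8 ℕ.* (5 ℕ.+ Lf)) * 1/ ε
  nonEmptyGroups<[2D+8D]/ε Lf {n} s R k ε≤1 1/ε<2^[1+Lf] inW propA propC propD 3≤k S<… =
    scaled-count⇒bound c (nonEmptyGroups R) (2 ℕ.* D) (8 ℕ.* D) U (1≤1/ε ε≤1)
      (nonEmptyGroups-bound R ε k E inW ≤E propC propD) U<…
    where
    open ≤-Reasoning
    E = 4 ℕ.+ Lf
    D = 5 ℕ.+ Lf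
    c = 2 ℕ.^ E ℕ.* (k ℕ.∸ 1)
    U = ∑ (allFin n) (λ i → 2 ℕ.^ (E ℕ.∸ level (R i)))
    ≤E : ∀ i → level (R i) ℕ.≤ E
    ≤E i = level-bound Lf 1/ε<2^[1+Lf] (inW i)
    U<… : toℚ U < toℚ (c ℕ.* (8 ℕ.* D)) * p
    U<… = begin-strict
      toℚ U                                     ≤⟨ weights≤two^*SIZE s R E propA ≤E ⟩
      two^ D * SIZE s                           <⟨ *-monoʳ-<-pos (two^ D) {{two^-pos D}} S<… ⟩
      two^ D * (toℚ (suc k ℕ.* (2 ℕ.* D)) * p)  ≡⟨ *-assoc (two^ D) _ p ⟨
      two^ D * toℚ (suc k ℕ.* (2 ℕ.* D)) * p    ≡⟨ cong (_* p) (toℚ-* (2 ℕ.^ D) _) ⟨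
      toℚ (2 ℕ.^ D ℕ.* (suc k ℕ.* (2 ℕ.* D))) * p
        ≤⟨ *-monoʳ-≤-nonNeg p (toℚ-mono-≤ (2^[1+E]*[1+k]*2D≤2^E*[k-1]*8D E D 3≤k)) ⟩
      toℚ (c ℕ.* (8 ℕ.* D)) * p                 ∎

  [2D+8D]/ε≤50[1+Lf]/ε : ∀ Lf →
    toℚ (2 ℕ.* (5 ℕ.+ Lf) ℕ.+ 8 ℕ.* (5 ℕ.+ Lf)) * 1/ ε ≤ toℚ 50 * 1/ ε * toℚ (suc Lf)
  [2D+8D]/ε≤50[1+Lf]/ε Lf = begin
    toℚ (2 ℕ.* (5 ℕ.+ Lf) ℕ.+ 8 ℕ.* (5 ℕ.+ Lf)) * p
      ≤⟨ *-monoʳ-≤-nonNeg p (toℚ-mono-≤ 2D+8D≤50[1+Lf]) ⟩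
    toℚ (50 ℕ.* suc Lf) * p      ≡⟨ cong (_* p) (toℚ-* 50 (suc Lf)) ⟩
    toℚ 50 * toℚ (suc Lf) * p    ≡⟨ solve 3 (λ a b q → a :* b :* q := a :* q :* b) refl (toℚ 50) (toℚ (suc Lf)) p ⟩
    toℚ 50 * p * toℚ (suc Lf)    ∎
    where
    open ≤-Reasoning
    2D+8D≤50[1+Lf] : 2 ℕ.* (5 ℕ.+ Lf) ℕ.+ 8 ℕ.* (5 ℕ.+ Lf) ℕ.≤ 50 ℕ.* suc Lf
    2D+8D≤50[1+Lf] = ℕ.≤-trans (ℕ.≤-reflexive (lhs Lf))
      (ℕ.≤-trans (ℕ.+-monoʳ-≤ 50 (ℕ.*-monoˡ-≤ Lf (ℕ.m≤m+n 10 40))) (ℕ.≤-reflexive (rhs Lf)))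
      where
      lhs : ∀ L → 2 ℕ.* (5 ℕ.+ L) ℕ.+ 8 ℕ.* (5 ℕ.+ L) ≡ 50 ℕ.+ 10 ℕ.* L
      lhs = solve-∀
      rhs : ∀ L → 50 ℕ.+ 50 ℕ.* L ≡ 50 ℕ.* suc L
      rhs = solve-∀

lemma1 : Σ ℕ λ C →
  (ε : ℚ) → .{{_ : NonZero ε}} → 0ℚ < ε → ε < 1ℚ →
  (Lf Lc : ℕ) →
  two^ Lf ≤ 1/ ε → 1/ ε < two^ (suc Lf) →
  1/ ε ≤ two^ Lc → two^ Lc < toℚ 2 * (1/ ε) →
  (n : ℕ) (s : Fin n → ℚ) →
  (∀ i → ε * ((+ 1) / 14) ≤ s i × s i ≤ 1ℚ) →
  toℚ 8 * (1/ ε) * toℚ (Lc Data.Nat.+ 5) < SIZE s →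
  (k : ℕ) → + k ≡ floor ((SIZE s * ε) * ((+ 1) / (2 Data.Nat.* (5 Data.Nat.+ Lf)))) →
  (R : Fin n → Group) → (∀ i → InW ε (level (R i))) →
  PropA s R → PropB s R → PropC ε R k → PropD ε R k →
  toℚ (nonEmptyGroups R) ≤ toℚ C * (1/ ε) * toℚ (suc Lf)
lemma1 .proj₁ = 50
lemma1 .proj₂ ε ε>0 ε<1 Lf Lc 2^Lf≤1/ε 1/ε<2^[1+Lf] 1/ε≤2^Lc _
              n s _ S-large k k≡⌊…⌋ R inW propA _ propC propD =
  ≤-trans (<⇒≤ (nonEmptyGroups<[2D+8D]/ε ε ε>0 Lf s R k (<⇒≤ ε<1) 1/ε<2^[1+Lf]
                  inW propA propC propD (ℕ.<⇒≤ 3<k) S<…))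
          ([2D+8D]/ε≤50[1+Lf]/ε ε ε>0 Lf)
  where
  S<… = floor-bound ε ε>0 (SIZE s) k (2 ℕ.* (5 ℕ.+ Lf)) k≡⌊…⌋
  Lf≤Lc = 2^-cancel-≤ (toℚ-cancel-≤ (≤-trans 2^Lf≤1/ε 1/ε≤2^Lc))
  5+Lf≤Lc+5 = ℕ.≤-trans (ℕ.+-monoʳ-≤ 5 Lf≤Lc) (ℕ.≤-reflexive (ℕ.+-comm 5 Lc))
  3<k = k-large ε ε>0 k (5 ℕ.+ Lf) (Lc ℕ.+ 5) 5+Lf≤Lc+5 S-large S<…
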